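{- For all integers $n,m,d\geqslant 0$, \[ s_{(m+1,1^n)}[s_d](q^{ -1},q)=s_{(n+1,1^m)}[s_{m-n+d}](q^{ -1},q). \]
   Context: For a partition $\mu$ and an integer $h\geqslant0$, $s_\mu[s_h](q^{ -1},q)$ denotes $s_\mu(q^{ -h},q^{ -h+2},\ldots,q^h)$, the Schur polynomial in $h+1$ variables evaluated at $q^{ -h+2j}$, $0\le j\le h$; for $h<0$ we use the convention $s_h=0$, so that $s_\mu[s_h](q^{ -1},q)=0$. The partition $(m+1,1^n)$ is the hook with first row $m+1$ followed by $n$ rows of length $1$. -}

module Defs where

open import Data.Nat using (ℕ; zero; suc; _<ᵇ_; _≤ᵇ_; _+_; _*_)
open import Data.Integer as ℤ using (ℤ; +_; -[1+_])
open import Data.Bool using (Bool; true; false; _∧_; if_then_else_)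
open import Data.List using (List; []; _∷_; map; concatMap; upTo; replicate; length; zip; concat)
open import Data.Nat.ListAction using (sum)
open import Data.Product using (_,_)

-- A Young diagram / partition is given by its list of row lengths
-- (weakly decreasing, positive parts); e.g. the hook (m+1,1^n).
hook : ℕ → ℕ → List ℕ
hook m n = suc m ∷ replicate n 1

words : ℕ → ℕ → List (List ℕ)
words zero    h = [] ∷ []
words (suc k) h = concatMap (λ a → map (a ∷_) (words k h)) (upTo (suc h))

weaklyInc : List ℕ → Bool
weaklyInc []           = true
weaklyInc (a ∷ [])     = true
weaklyInc (a ∷ b ∷ xs) = (a ≤ᵇ b) ∧ weaklyInc (b ∷ xs)

filterᵇ' : {A : Set} → (A → Bool) → List A → List A
filterᵇ' p []       = []
filterᵇ' p (x ∷ xs) = if p x then x ∷ filterᵇ' p xs else filterᵇ' p xs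

rowFillings : List ℕ → ℕ → List (List (List ℕ))
rowFillings []      h = [] ∷ []
rowFillings (l ∷ λs) h =
  concatMap (λ r → map (r ∷_) (rowFillings λs h)) (filterᵇ' weaklyInc (words l h))

-- strictly increasing down columns (row i above row i+1, zip truncates to the shorter row)
allᵇ : {A : Set} → (A → Bool) → List A → Bool
allᵇ p []       = true
allᵇ p (x ∷ xs) = p x ∧ allᵇ p xs

colStrict : List (List ℕ) → Bool
colStrict []             = true
colStrict (r ∷ [])       = true
colStrict (r ∷ s ∷ rows) =
  allᵇ (λ { (a , b) → a <ᵇ b }) (zip r s) ∧ colStrict (s ∷ rows)

SSYT : List ℕ → ℕ → List (List (List ℕ))
SSYT λs h = filterᵇ' colStrict (rowFillings λs h)

-- exponent of q in the monomial x^T with x_j = q^{-h+2j}: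
-- Σ_{cells} (-h + 2 T(cell)) = 2 Σ T - h·|λ|
qExp : ℕ → List (List ℕ) → ℤ
qExp h T = (+ (2 * sum (concat T))) ℤ.- (+ (h * length (concat T)))

-- s_λ[s_h](q^{-1},q) = s_λ(q^{-h},q^{-h+2},…,q^h) as a Laurent polynomial in q
-- with nonnegative integer coefficients, represented as the multiset (list) of
-- exponents of its monomials (one per SSYT).  Equality of such Laurent
-- polynomials is equality of multisets, i.e. permutation _↭_.
-- Convention: for h < 0, s_h = 0, so the result is the zero polynomial [].
schurPS : List ℕ → ℤ → List ℤ
schurPS λs (+ h)      = map (qExp h) (SSYT λs h)
schurPS λs -[1+ _ ]   = []

-- A semistandard tableau of hook shape (m+1, 1^n) with entries in {0, …, h} consists of a corner
-- entry a, a weakly increasing arm of m entries in [a, h] and a strictly increasing leg of n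
-- entries in (a, h], whose entry sums are generated by q^(ma) [m + h - a choose m]_q and
-- q^(na + n(n+1)/2) [h - a choose n]_q.  For h = n + K only corners a ≤ K contribute, and with
-- r = K - a the corner term is q^(a(m+n+1) + n(n+1)/2) times the q-multinomial coefficient
-- [m + n + r]_q! / ([m]_q! [n]_q! [r]_q!), which is symmetric in m and n.  Hence the entry-sum
-- generating functions of (m+1, 1^n) at h = n + K and of (n+1, 1^m) at h = m + K agree after
-- multiplying by q^(m(m+1)/2) and q^(n(n+1)/2) respectively.  The principal specialisation
-- records 2 Σ T - h |λ| instead of Σ T, and the two normalisations match because
-- (n + K)(m + n + 1) + m(m + 1) is symmetric in m and n.  For d < n both sides vanish.
module Submission where

open import Defs

module HookSchur where

  open import Algebra.Bundles using (CommutativeMonoid)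
  open import Data.Bool using (Bool; true; false; _∧_; if_then_else_)
  open import Data.Bool.Properties using (∧-identityʳ; if-float)
  open import Data.List
    using (List; []; _∷_; _++_; [_]; map; concat; concatMap; upTo; applyUpTo; replicate; length)
  open import Data.List.Properties
    using (map-++; map-∘; map-id; map-cong; map-cong-local; ++-assoc; ++-identityʳ; length-++;
           concatMap-cong; concatMap-map; map-concatMap; concatMap-++; concatMap-pure; concat-map-[_])
  open import Data.List.Relation.Unary.All as All using (All; []; _∷_)
  open import Data.List.Relation.Unary.All.Properties as All using (all-upTo)
  open import Data.List.Relation.Binary.Permutation.Propositional
    using (_↭_; ↭-refl; ↭-sym; ↭-trans; ↭-reflexive; ↭-prep; module PermutationReasoning)
  import Data.List.Relation.Binary.Permutation.Propositional as ↭
  open import Data.List.Relation.Binary.Permutation.Propositional.Properties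
    using (map⁺; ++⁺; ++⁺ˡ; ++⁺ʳ; shifts; ++-commutativeMonoid)
  open import Data.Nat using (ℕ; zero; suc; _+_; _*_; _∸_; _≤_; _<_; _≤ᵇ_; _<ᵇ_; s≤s⁻¹)
  open import Data.Nat.Properties
    using (+-comm; +-assoc; +-suc; +-identityʳ; *-zeroʳ; *-identityʳ; *-distribˡ-+; +-∸-assoc; m≤n⇒m∸n≡0;
           ≤-refl; ≤-trans; <-≤-trans; n≤1+n; m≤m+n; m≤n+m; +-monoˡ-≤; +-monoˡ-<; m≤n⇒∃[o]m+o≡n)
  open import Data.Integer as ℤ using (ℤ)
  open import Data.Integer.Properties using (pos-+)
  open import Data.Integer.Tactic.RingSolver using () renaming (solve-∀ to ℤ-solve-∀)
  open import Data.Nat.ListAction using (sum)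
  open import Data.Nat.ListAction.Properties using (sum-++)
  open import Data.Nat.Tactic.RingSolver using (solve-∀)
  open import Data.Product using (_,_)
  open import Function using (_∘_)
  open import Relation.Binary.PropositionalEquality
    using (_≡_; _≗_; refl; sym; trans; cong; cong₂; subst; module ≡-Reasoning)

  open import Algebra.Properties.CommutativeSemigroup
    (CommutativeMonoid.commutativeSemigroup (++-commutativeMonoid {A = ℕ}))
    using () renaming (interchange to ++-interchange)

  private
    variable
      A B C : Set

  filterᵇ'-++ : (p : A → Bool) (xs ys : List A) →
                filterᵇ' p (xs ++ ys) ≡ filterᵇ' p xs ++ filterᵇ' p ys
  filterᵇ'-++ p []       ys = refl
  filterᵇ'-++ p (x ∷ xs) ys with p x
  ... | true  = cong (x ∷_) (filterᵇ'-++ p xs ys)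
  ... | false = filterᵇ'-++ p xs ys

  filterᵇ'-concatMap : (p : B → Bool) (f : A → List B) (xs : List A) →
                       filterᵇ' p (concatMap f xs) ≡ concatMap (filterᵇ' p ∘ f) xs
  filterᵇ'-concatMap p f []       = refl
  filterᵇ'-concatMap p f (x ∷ xs) =
    trans (filterᵇ'-++ p (f x) (concatMap f xs)) (cong (filterᵇ' p (f x) ++_) (filterᵇ'-concatMap p f xs))

  filterᵇ'-map : (p : B → Bool) (f : A → B) (xs : List A) →
                 filterᵇ' p (map f xs) ≡ map f (filterᵇ' (p ∘ f) xs)
  filterᵇ'-map p f []       = refl
  filterᵇ'-map p f (x ∷ xs) with p (f x)
  ... | true  = cong (f x ∷_) (filterᵇ'-map p f xs)
  ... | false = filterᵇ'-map p f xs

  filterᵇ'-cong : {p q : A → Bool} → p ≗ q → filterᵇ' p ≗ filterᵇ' q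
  filterᵇ'-cong p≗q []       = refl
  filterᵇ'-cong {q = q} p≗q (x ∷ xs) rewrite p≗q x with q x
  ... | true  = cong (x ∷_) (filterᵇ'-cong p≗q xs)
  ... | false = filterᵇ'-cong p≗q xs

  filterᵇ'-true : (xs : List A) → filterᵇ' (λ _ → true) xs ≡ xs
  filterᵇ'-true []       = refl
  filterᵇ'-true (x ∷ xs) = cong (x ∷_) (filterᵇ'-true xs)

  filterᵇ'-false : (xs : List A) → filterᵇ' (λ _ → false) xs ≡ []
  filterᵇ'-false []       = refl
  filterᵇ'-false (x ∷ xs) = filterᵇ'-false xs

  filterᵇ'-∧ˡ : ∀ b (p : A → Bool) xs → filterᵇ' (λ x → b ∧ p x) xs ≡ (if b then filterᵇ' p xs else [])
  filterᵇ'-∧ˡ true  p xs = refl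
  filterᵇ'-∧ˡ false p xs = filterᵇ'-false xs

  concatMap-filterᵇ' : (f : A → List B) (p : A → Bool) (xs : List A) →
                       concatMap f (filterᵇ' p xs) ≡ concatMap (λ x → if p x then f x else []) xs
  concatMap-filterᵇ' f p []       = refl
  concatMap-filterᵇ' f p (x ∷ xs) with p x
  ... | true  = cong (f x ++_) (concatMap-filterᵇ' f p xs)
  ... | false = concatMap-filterᵇ' f p xs

  All-filterᵇ' : {P : A → Set} (p : A → Bool) {xs : List A} → All P xs → All P (filterᵇ' p xs)
  All-filterᵇ' p []                  = []
  All-filterᵇ' p {x ∷ xs} (px ∷ pxs) with p x
  ... | true  = px ∷ All-filterᵇ' p pxs
  ... | false = All-filterᵇ' p pxs

  concatMap-[] : {f : A → List B} {xs : List A} → All (λ x → f x ≡ []) xs → concatMap f xs ≡ []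
  concatMap-[]                []           = refl
  concatMap-[] {f = f} {x ∷ xs} (fx≡[] ∷ ps) = trans (cong (_++ concatMap f xs) fx≡[]) (concatMap-[] ps)

  concatMap-cong-↭ : {f g : A → List B} {xs : List A} → All (λ x → f x ↭ g x) xs →
                concatMap f xs ↭ concatMap g xs
  concatMap-cong-↭ []       = ↭-refl
  concatMap-cong-↭ (p ∷ ps) = ++⁺ p (concatMap-cong-↭ ps)

  concatMap-concatMap : (f : B → List C) (g : A → List B) (xs : List A) →
                        concatMap f (concatMap g xs) ≡ concatMap (concatMap f ∘ g) xs
  concatMap-concatMap f g []       = refl
  concatMap-concatMap f g (x ∷ xs) =
    trans (concatMap-++ f (g x) (concatMap g xs)) (cong (concatMap f (g x) ++_) (concatMap-concatMap f g xs))

  concatMap⁺ : (f : A → List B) {xs ys : List A} → xs ↭ ys → concatMap f xs ↭ concatMap f ys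
  concatMap⁺ f ↭.refl                    = ↭-refl
  concatMap⁺ f (↭.prep x p)              = ++⁺ˡ (f x) (concatMap⁺ f p)
  concatMap⁺ f (↭.swap x y p)            =
    ↭-trans (shifts (f x) (f y)) (++⁺ˡ (f y) (++⁺ˡ (f x) (concatMap⁺ f p)))
  concatMap⁺ f (↭.trans p q)             = ↭-trans (concatMap⁺ f p) (concatMap⁺ f q)

  concatMap-++-↭ : (f g : A → List ℕ) (xs : List A) →
                   concatMap (λ x → f x ++ g x) xs ↭ concatMap f xs ++ concatMap g xs
  concatMap-++-↭ f g []       = ↭-refl
  concatMap-++-↭ f g (x ∷ xs) = begin
    (f x ++ g x) ++ concatMap (λ x → f x ++ g x) xs     ↭⟨ ++⁺ˡ (f x ++ g x) (concatMap-++-↭ f g xs) ⟩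
    (f x ++ g x) ++ (concatMap f xs ++ concatMap g xs)  ↭⟨ ++-interchange (f x) (g x) _ _ ⟩
    (f x ++ concatMap f xs) ++ (g x ++ concatMap g xs)  ∎
    where open PermutationReasoning

  range : ℕ → ℕ → List ℕ
  range lo zero    = []
  range lo (suc n) = lo ∷ range (suc lo) n

  range-suc : ∀ lo n → range (suc lo) n ≡ map suc (range lo n)
  range-suc lo zero    = refl
  range-suc lo (suc n) = cong (suc lo ∷_) (range-suc (suc lo) n)

  applyUpTo-range : (f : ℕ → A) (n : ℕ) → applyUpTo f n ≡ map f (range 0 n)
  applyUpTo-range f zero    = refl
  applyUpTo-range f (suc n) = cong (f 0 ∷_) (begin
    applyUpTo (f ∘ suc) n       ≡⟨ applyUpTo-range (f ∘ suc) n ⟩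
    map (f ∘ suc) (range 0 n)   ≡⟨ map-∘ (range 0 n) ⟩
    map f (map suc (range 0 n)) ≡⟨ cong (map f) (range-suc 0 n) ⟨
    map f (range 1 n)           ∎)
    where open ≡-Reasoning

  upTo-range : ∀ n → upTo n ≡ range 0 n
  upTo-range n = trans (applyUpTo-range (λ x → x) n) (map-id (range 0 n))

  range-++ : ∀ lo m n → range lo (m + n) ≡ range lo m ++ range (lo + m) n
  range-++ lo zero    n = cong (λ x → range x n) (sym (+-identityʳ lo))
  range-++ lo (suc m) n =
    cong (lo ∷_) (trans (range-++ (suc lo) m n) (cong (λ x → range (suc lo) m ++ range x n) (sym (+-suc lo m))))

  range-lowerBound : ∀ lo n → All (lo ≤_) (range lo n)
  range-lowerBound lo zero    = []
  range-lowerBound lo (suc n) = ≤-refl ∷ All.map (≤-trans (n≤1+n lo)) (range-lowerBound (suc lo) n)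

  suc-≤ᵇ-suc : ∀ m n → (suc m ≤ᵇ suc n) ≡ (m ≤ᵇ n)
  suc-≤ᵇ-suc zero    n = refl
  suc-≤ᵇ-suc (suc m) n = refl

  filterᵇ'-≤ᵇ-range : ∀ lo n → filterᵇ' (lo ≤ᵇ_) (range 0 n) ≡ range lo (n ∸ lo)
  filterᵇ'-≤ᵇ-range zero     n       = filterᵇ'-true (range 0 n)
  filterᵇ'-≤ᵇ-range (suc lo) zero    = refl
  filterᵇ'-≤ᵇ-range (suc lo) (suc n) = begin
    filterᵇ' (suc lo ≤ᵇ_) (range 1 n)
      ≡⟨ cong (filterᵇ' (suc lo ≤ᵇ_)) (range-suc 0 n) ⟩
    filterᵇ' (suc lo ≤ᵇ_) (map suc (range 0 n))
      ≡⟨ filterᵇ'-map (suc lo ≤ᵇ_) suc (range 0 n) ⟩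
    map suc (filterᵇ' (λ a → suc lo ≤ᵇ suc a) (range 0 n))
      ≡⟨ cong (map suc) (filterᵇ'-cong (suc-≤ᵇ-suc lo) (range 0 n)) ⟩
    map suc (filterᵇ' (lo ≤ᵇ_) (range 0 n))
      ≡⟨ cong (map suc) (filterᵇ'-≤ᵇ-range lo n) ⟩
    map suc (range lo (n ∸ lo))
      ≡⟨ range-suc lo (n ∸ lo) ⟨
    range (suc lo) (n ∸ lo)
      ∎
    where open ≡-Reasoning

  filterᵇ'-≤ᵇ-upTo : ∀ lo n → filterᵇ' (lo ≤ᵇ_) (upTo n) ≡ range lo (n ∸ lo)
  filterᵇ'-≤ᵇ-upTo lo n = trans (cong (filterᵇ' (lo ≤ᵇ_)) (upTo-range n)) (filterᵇ'-≤ᵇ-range lo n)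

  -- A polynomial with coefficients in ℕ is the list, up to ↭, of the exponents of its monomials:
  -- shift c multiplies by q^c and ⊗ is the product.
  shift : ℕ → List ℕ → List ℕ
  shift c = map (c +_)

  infixl 7 _⊗_
  _⊗_ : List ℕ → List ℕ → List ℕ
  xs ⊗ ys = concatMap (λ x → shift x ys) xs

  shift-shift : ∀ a b xs → shift a (shift b xs) ≡ shift (a + b) xs
  shift-shift a b xs = trans (sym (map-∘ xs)) (map-cong (λ x → sym (+-assoc a b x)) xs)

  shift-comm : ∀ a b xs → shift a (shift b xs) ≡ shift b (shift a xs)
  shift-comm a b xs =
    trans (shift-shift a b xs) (trans (cong (λ c → shift c xs) (+-comm a b)) (sym (shift-shift b a xs)))

  shift-++-shift : ∀ c xs d ys → shift c (xs ++ shift d ys) ≡ shift c xs ++ shift (c + d) ys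
  shift-++-shift c xs d ys = trans (map-++ (c +_) xs (shift d ys)) (cong (shift c xs ++_) (shift-shift c d ys))

  ⊗-identityˡ : ∀ xs → (0 ∷ []) ⊗ xs ≡ xs
  ⊗-identityˡ xs = trans (++-identityʳ (shift 0 xs)) (map-id xs)

  ⊗-identityʳ : ∀ xs → xs ⊗ (0 ∷ []) ≡ xs
  ⊗-identityʳ []       = refl
  ⊗-identityʳ (x ∷ xs) = cong₂ _∷_ (+-identityʳ x) (⊗-identityʳ xs)

  ⊗-zeroʳ : ∀ xs → xs ⊗ [] ≡ []
  ⊗-zeroʳ []       = refl
  ⊗-zeroʳ (x ∷ xs) = ⊗-zeroʳ xs

  ⊗-shiftˡ : ∀ c xs ys → shift c xs ⊗ ys ≡ shift c (xs ⊗ ys)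
  ⊗-shiftˡ c xs ys = begin
    concatMap (λ x → shift x ys) (map (c +_) xs)   ≡⟨ concatMap-map (λ x → shift x ys) (c +_) xs ⟩
    concatMap (λ x → shift (c + x) ys) xs          ≡⟨ concatMap-cong (λ x → sym (shift-shift c x ys)) xs ⟩
    concatMap (λ x → shift c (shift x ys)) xs      ≡⟨ map-concatMap (c +_) (λ x → shift x ys) xs ⟨
    shift c (xs ⊗ ys)                              ∎
    where open ≡-Reasoning

  ⊗-shiftʳ : ∀ c xs ys → xs ⊗ shift c ys ≡ shift c (xs ⊗ ys)
  ⊗-shiftʳ c xs ys = trans (concatMap-cong (λ x → shift-comm x c ys) xs)
                           (sym (map-concatMap (c +_) (λ x → shift x ys) xs))

  shift-⊗-shift : ∀ c xs d ys → shift c xs ⊗ shift d ys ≡ shift (c + d) (xs ⊗ ys)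
  shift-⊗-shift c xs d ys = begin
    shift c xs ⊗ shift d ys      ≡⟨ ⊗-shiftˡ c xs (shift d ys) ⟩
    shift c (xs ⊗ shift d ys)    ≡⟨ cong (shift c) (⊗-shiftʳ d xs ys) ⟩
    shift c (shift d (xs ⊗ ys))  ≡⟨ shift-shift c d (xs ⊗ ys) ⟩
    shift (c + d) (xs ⊗ ys)      ∎
    where open ≡-Reasoning

  ⊗-++ʳ : ∀ xs ys zs → xs ⊗ (ys ++ zs) ↭ xs ⊗ ys ++ xs ⊗ zs
  ⊗-++ʳ xs ys zs = ↭-trans (↭-reflexive (concatMap-cong (λ x → map-++ (x +_) ys zs) xs))
                           (concatMap-++-↭ (λ x → shift x ys) (λ x → shift x zs) xs)

  ⊗-congˡ : ∀ {xs ys} zs → xs ↭ ys → xs ⊗ zs ↭ ys ⊗ zs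
  ⊗-congˡ zs = concatMap⁺ (λ x → shift x zs)

  ⊗-congʳ : ∀ xs {ys zs} → ys ↭ zs → xs ⊗ ys ↭ xs ⊗ zs
  ⊗-congʳ xs ys↭zs = concatMap-cong-↭ (All.universal (λ x → map⁺ (x +_) ys↭zs) xs)

  shift-map-⊗ : ∀ c (f g : A → ℕ) xs ys →
                shift c (map f xs ⊗ map g ys) ≡ concatMap (λ x → map (λ y → c + (f x + g y)) ys) xs
  shift-map-⊗ c f g xs ys = begin
    shift c (concatMap (λ u → shift u (map g ys)) (map f xs))
      ≡⟨ cong (shift c) (concatMap-map _ f xs) ⟩
    shift c (concatMap (λ x → shift (f x) (map g ys)) xs)
      ≡⟨ map-concatMap (c +_) _ xs ⟩
    concatMap (λ x → shift c (shift (f x) (map g ys))) xs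
      ≡⟨ concatMap-cong (λ x → trans (sym (map-∘ (map g ys))) (sym (map-∘ ys))) xs ⟩
    concatMap (λ x → map (λ y → c + (f x + g y)) ys) xs
      ∎
    where open ≡-Reasoning

  -- gaussian a b is [a + b choose a]_q.
  gaussian : ℕ → ℕ → List ℕ
  gaussian zero    b       = 0 ∷ []
  gaussian (suc a) zero    = 0 ∷ []
  gaussian (suc a) (suc b) = gaussian a (suc b) ++ shift (suc a) (gaussian (suc a) b)

  gaussian-zeroʳ : ∀ a → gaussian a 0 ≡ 0 ∷ []
  gaussian-zeroʳ zero    = refl
  gaussian-zeroʳ (suc a) = refl

  gaussian-pascalʳ : ∀ a b → gaussian (suc a) (suc b) ↭ gaussian (suc a) b ++ shift (suc b) (gaussian a (suc b))
  gaussian-pascalʳ zero zero = ↭-refl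
  gaussian-pascalʳ zero (suc b) =
    ↭-prep 0 (↭-trans (map⁺ suc (gaussian-pascalʳ zero b)) (↭-reflexive (map-++ suc (gaussian 1 b) _)))
  gaussian-pascalʳ (suc a) zero =
    ↭-trans (++⁺ʳ _ (gaussian-pascalʳ a zero)) (↭-prep 0 (↭-reflexive (sym (map-++ suc (gaussian a 1) _))))
  gaussian-pascalʳ (suc a) (suc b) = begin
    gaussian (suc a) (2 + b) ++ shift (2 + a) (gaussian (2 + a) (suc b))
      ↭⟨ ++⁺ (gaussian-pascalʳ a (suc b)) (map⁺ (2 + a +_) (gaussian-pascalʳ (suc a) b)) ⟩
    (X ++ shift (2 + b) Y) ++ shift (2 + a) (Z ++ shift (suc b) X)
      ≡⟨ cong ((X ++ shift (2 + b) Y) ++_) (shift-++-shift (2 + a) Z (suc b) X) ⟩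
    (X ++ shift (2 + b) Y) ++ (shift (2 + a) Z ++ shift (2 + a + suc b) X)
      ↭⟨ ++-interchange X (shift (2 + b) Y) (shift (2 + a) Z) (shift (2 + a + suc b) X) ⟩
    (X ++ shift (2 + a) Z) ++ (shift (2 + b) Y ++ shift (2 + a + suc b) X)
      ≡⟨ cong (λ c → (X ++ shift (2 + a) Z) ++ (shift (2 + b) Y ++ shift c X)) (exponents-swap a b) ⟩
    (X ++ shift (2 + a) Z) ++ (shift (2 + b) Y ++ shift (2 + b + suc a) X)
      ≡⟨ cong ((X ++ shift (2 + a) Z) ++_) (shift-++-shift (2 + b) Y (suc a) X) ⟨
    gaussian (2 + a) (suc b) ++ shift (2 + b) (gaussian (suc a) (2 + b))
      ∎
    where
      open PermutationReasoning
      X = gaussian (suc a) (suc b)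
      Y = gaussian a (2 + b)
      Z = gaussian (2 + a) b
      exponents-swap : ∀ a b → 2 + a + suc b ≡ 2 + b + suc a
      exponents-swap = solve-∀

  gaussian-comm : ∀ a b → gaussian a b ↭ gaussian b a
  gaussian-comm zero    zero    = ↭-refl
  gaussian-comm zero    (suc b) = ↭-refl
  gaussian-comm (suc a) zero    = ↭-refl
  gaussian-comm (suc a) (suc b) =
    ↭-trans (++⁺ (gaussian-comm a (suc b)) (map⁺ (suc a +_) (gaussian-comm (suc a) b)))
            (↭-sym (gaussian-pascalʳ b a))

  -- The q-multinomial coefficient [m + n + k]_q! / ([m]_q! [n]_q! [k]_q!).
  trinomial : ℕ → ℕ → ℕ → List ℕ
  trinomial m n k = gaussian m (n + k) ⊗ gaussian n k

  trinomial-unfoldˡ : ∀ m n k →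
    trinomial (suc m) (suc n) (suc k) ↭
    trinomial m (suc n) (suc k) ++ shift (suc m) (trinomial (suc m) (suc n) k)
                                ++ shift (suc m + suc k) (trinomial (suc m) n (suc k))
  trinomial-unfoldˡ m n k = begin
    trinomial (suc m) (suc n) (suc k)
      ≡⟨ concatMap-++ (λ x → shift x G) (gaussian m (suc n + suc k)) _ ⟩
    trinomial m (suc n) (suc k) ++ shift (suc m) X ⊗ G
      ≡⟨ cong (trinomial m (suc n) (suc k) ++_) (⊗-shiftˡ (suc m) X G) ⟩
    trinomial m (suc n) (suc k) ++ shift (suc m) (X ⊗ G)
      ↭⟨ ++⁺ˡ (trinomial m (suc n) (suc k)) (map⁺ (suc m +_) (begin
          X ⊗ G
            ↭⟨ ⊗-congʳ X (gaussian-pascalʳ n k) ⟩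
          X ⊗ (gaussian (suc n) k ++ shift (suc k) (gaussian n (suc k)))
            ↭⟨ ⊗-++ʳ X (gaussian (suc n) k) (shift (suc k) (gaussian n (suc k))) ⟩
          X ⊗ gaussian (suc n) k ++ X ⊗ shift (suc k) (gaussian n (suc k))
            ≡⟨ cong₂ _++_ (cong (λ j → gaussian (suc m) j ⊗ gaussian (suc n) k) (+-suc n k))
                          (⊗-shiftʳ (suc k) X (gaussian n (suc k))) ⟩
          trinomial (suc m) (suc n) k ++ shift (suc k) (trinomial (suc m) n (suc k))
            ∎)) ⟩
    trinomial m (suc n) (suc k) ++
      shift (suc m) (trinomial (suc m) (suc n) k ++ shift (suc k) (trinomial (suc m) n (suc k)))
      ≡⟨ cong (trinomial m (suc n) (suc k) ++_)
              (shift-++-shift (suc m) (trinomial (suc m) (suc n) k) (suc k) (trinomial (suc m) n (suc k))) ⟩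
    trinomial m (suc n) (suc k) ++ shift (suc m) (trinomial (suc m) (suc n) k)
                                ++ shift (suc m + suc k) (trinomial (suc m) n (suc k))
      ∎
    where
      open PermutationReasoning
      G = gaussian (suc n) (suc k)
      X = gaussian (suc m) (n + suc k)

  trinomial-unfoldʳ : ∀ m n k →
    trinomial (suc m) (suc n) (suc k) ↭
    trinomial (suc m) n (suc k) ++ shift (suc n) (trinomial (suc m) (suc n) k)
                                ++ shift (suc n + suc k) (trinomial m (suc n) (suc k))
  trinomial-unfoldʳ m n k = begin
    gaussian (suc m) (suc n + suc k) ⊗ G
      ↭⟨ ⊗-congˡ G (gaussian-pascalʳ m (n + suc k)) ⟩
    (X ++ shift (suc n + suc k) (gaussian m (suc n + suc k))) ⊗ G
      ≡⟨ trans (concatMap-++ (λ x → shift x G) X (shift (suc n + suc k) (gaussian m (suc n + suc k))))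
               (cong (X ⊗ G ++_) (⊗-shiftˡ (suc n + suc k) (gaussian m (suc n + suc k)) G)) ⟩
    X ⊗ G ++ shift (suc n + suc k) (trinomial m (suc n) (suc k))
      ↭⟨ ++⁺ʳ (shift (suc n + suc k) (trinomial m (suc n) (suc k))) (begin
          X ⊗ (gaussian n (suc k) ++ shift (suc n) (gaussian (suc n) k))
            ↭⟨ ⊗-++ʳ X (gaussian n (suc k)) (shift (suc n) (gaussian (suc n) k)) ⟩
          trinomial (suc m) n (suc k) ++ X ⊗ shift (suc n) (gaussian (suc n) k)
            ≡⟨ cong (trinomial (suc m) n (suc k) ++_)
                    (trans (⊗-shiftʳ (suc n) X (gaussian (suc n) k))
                           (cong (λ j → shift (suc n) (gaussian (suc m) j ⊗ gaussian (suc n) k)) (+-suc n k))) ⟩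
          trinomial (suc m) n (suc k) ++ shift (suc n) (trinomial (suc m) (suc n) k)
            ∎) ⟩
    (trinomial (suc m) n (suc k) ++ shift (suc n) (trinomial (suc m) (suc n) k))
      ++ shift (suc n + suc k) (trinomial m (suc n) (suc k))
      ≡⟨ ++-assoc (trinomial (suc m) n (suc k)) (shift (suc n) (trinomial (suc m) (suc n) k)) _ ⟩
    trinomial (suc m) n (suc k) ++ shift (suc n) (trinomial (suc m) (suc n) k)
                                ++ shift (suc n + suc k) (trinomial m (suc n) (suc k))
      ∎
    where
      open PermutationReasoning
      G = gaussian (suc n) (suc k)
      X = gaussian (suc m) (n + suc k)

  trinomial-comm : ∀ m n k → trinomial m n k ↭ trinomial n m k
  trinomial-comm zero n k =
    ↭-reflexive (trans (⊗-identityˡ (gaussian n k)) (sym (⊗-identityʳ (gaussian n k))))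
  trinomial-comm (suc m) zero k =
    ↭-reflexive (trans (⊗-identityʳ (gaussian (suc m) k)) (sym (⊗-identityˡ (gaussian (suc m) k))))
  trinomial-comm (suc m) (suc n) zero = begin
    gaussian (suc m) (suc n + 0) ⊗ (0 ∷ [])
      ≡⟨ trans (⊗-identityʳ _) (cong (gaussian (suc m)) (+-identityʳ (suc n))) ⟩
    gaussian (suc m) (suc n)
      ↭⟨ gaussian-comm (suc m) (suc n) ⟩
    gaussian (suc n) (suc m)
      ≡⟨ trans (⊗-identityʳ _) (cong (gaussian (suc n)) (+-identityʳ (suc m))) ⟨
    gaussian (suc n) (suc m + 0) ⊗ (0 ∷ [])
      ∎
    where open PermutationReasoning
  trinomial-comm (suc m) (suc n) (suc k) = begin
    trinomial (suc m) (suc n) (suc k)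
      ↭⟨ trinomial-unfoldˡ m n k ⟩
    trinomial m (suc n) (suc k) ++ shift (suc m) (trinomial (suc m) (suc n) k)
                                ++ shift (suc m + suc k) (trinomial (suc m) n (suc k))
      ↭⟨ ++⁺ (trinomial-comm m (suc n) (suc k))
             (++⁺ (map⁺ (suc m +_) (trinomial-comm (suc m) (suc n) k))
                  (map⁺ (suc m + suc k +_) (trinomial-comm (suc m) n (suc k)))) ⟩
    trinomial (suc n) m (suc k) ++ shift (suc m) (trinomial (suc n) (suc m) k)
                                ++ shift (suc m + suc k) (trinomial n (suc m) (suc k))
      ↭⟨ trinomial-unfoldʳ n m k ⟨
    trinomial (suc n) (suc m) (suc k)
      ∎
    where open PermutationReasoning

  -- chainFrom s p (x₁ ∷ … ∷ x_k) holds iff p + s ≤ x₁ and xᵢ + s ≤ xᵢ₊₁: weakly increasing above p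
  -- for s = 0, strictly for s = 1.
  chainFrom : ℕ → ℕ → List ℕ → Bool
  chainFrom s p []      = true
  chainFrom s p (x ∷ w) = (s + p ≤ᵇ x) ∧ chainFrom s x w

  chainSums : ℕ → ℕ → ℕ → ℕ → List ℕ
  chainSums s k p h = map sum (filterᵇ' (chainFrom s p) (words k h))

  filterᵇ'-words-suc : ∀ (P : List ℕ → Bool) k h →
    filterᵇ' P (words (suc k) h) ≡
    concatMap (λ a → map (a ∷_) (filterᵇ' (P ∘ (a ∷_)) (words k h))) (upTo (suc h))
  filterᵇ'-words-suc P k h =
    trans (filterᵇ'-concatMap P (λ a → map (a ∷_) (words k h)) (upTo (suc h)))
          (concatMap-cong (λ a → filterᵇ'-map P (a ∷_) (words k h)) (upTo (suc h)))

  map-sum-∷ : ∀ a (ws : List (List ℕ)) → map sum (map (a ∷_) ws) ≡ shift a (map sum ws)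
  map-sum-∷ a ws = trans (sym (map-∘ ws)) (map-∘ ws)

  chainSums-suc : ∀ s k p h →
    chainSums s (suc k) p h ≡ concatMap (λ a → shift a (chainSums s k a h)) (range (s + p) (suc h ∸ (s + p)))
  chainSums-suc s k p h = begin
    map sum (filterᵇ' (chainFrom s p) (words (suc k) h))
      ≡⟨ cong (map sum) (filterᵇ'-words-suc (chainFrom s p) k h) ⟩
    map sum (concatMap (λ a → map (a ∷_) (filterᵇ' (λ w → above a ∧ chainFrom s a w) W)) U)
      ≡⟨ map-concatMap sum (λ a → map (a ∷_) (filterᵇ' (λ w → above a ∧ chainFrom s a w) W)) U ⟩
    concatMap (λ a → map sum (map (a ∷_) (filterᵇ' (λ w → above a ∧ chainFrom s a w) W))) U
      ≡⟨ concatMap-cong restrict U ⟩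
    concatMap (λ a → if above a then g a else []) U
      ≡⟨ concatMap-filterᵇ' g above U ⟨
    concatMap g (filterᵇ' above U)
      ≡⟨ cong (concatMap g) (filterᵇ'-≤ᵇ-upTo (s + p) (suc h)) ⟩
    concatMap g (range (s + p) (suc h ∸ (s + p)))
      ∎
    where
      open ≡-Reasoning
      W = words k h
      U = upTo (suc h)
      above : ℕ → Bool
      above a = s + p ≤ᵇ a
      g : ℕ → List ℕ
      g a = shift a (chainSums s k a h)
      restrict : ∀ a → map sum (map (a ∷_) (filterᵇ' (λ w → above a ∧ chainFrom s a w) W))
                     ≡ (if above a then g a else [])
      restrict a = begin
        map sum (map (a ∷_) (filterᵇ' (λ w → above a ∧ chainFrom s a w) W))
          ≡⟨ cong (map sum ∘ map (a ∷_)) (filterᵇ'-∧ˡ (above a) (chainFrom s a) W) ⟩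
        map sum (map (a ∷_) (if above a then filterᵇ' (chainFrom s a) W else []))
          ≡⟨ if-float (map sum ∘ map (a ∷_)) (above a) ⟩
        (if above a then map sum (map (a ∷_) (filterᵇ' (chainFrom s a) W)) else [])
          ≡⟨ cong (λ xs → if above a then xs else []) (map-sum-∷ a (filterᵇ' (chainFrom s a) W)) ⟩
        (if above a then g a else [])
          ∎

  chainSums-step : ∀ s k p h → s + p ≤ h →
    chainSums s (suc k) p h ≡ shift (s + p) (chainSums s k (s + p) h) ++ chainSums s (suc k) (suc p) h
  chainSums-step s k p h s+p≤h = begin
    chainSums s (suc k) p h
      ≡⟨ chainSums-suc s k p h ⟩
    concatMap g (range (s + p) (suc h ∸ (s + p)))
      ≡⟨ cong (concatMap g ∘ range (s + p)) (+-∸-assoc 1 s+p≤h) ⟩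
    g (s + p) ++ concatMap g (range (suc (s + p)) (h ∸ (s + p)))
      ≡⟨ cong (λ q → g (s + p) ++ concatMap g (range q (suc h ∸ q))) (+-suc s p) ⟨
    g (s + p) ++ concatMap g (range (s + suc p) (suc h ∸ (s + suc p)))
      ≡⟨ cong (g (s + p) ++_) (chainSums-suc s k (suc p) h) ⟨
    g (s + p) ++ chainSums s (suc k) (suc p) h
      ∎
    where
      open ≡-Reasoning
      g : ℕ → List ℕ
      g a = shift a (chainSums s k a h)

  chainSums-empty : ∀ s k p h → h < p + s * suc k → chainSums s (suc k) p h ≡ []
  chainSums-empty s zero p h h<s+p = trans (chainSums-suc s 0 p h)
    (cong (concatMap (λ a → shift a (chainSums s 0 a h)) ∘ range (s + p))
          (m≤n⇒m∸n≡0 (subst (h <_) (trans (cong (p +_) (*-identityʳ s)) (+-comm p s)) h<s+p)))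
  chainSums-empty s (suc k) p h h<bound = trans (chainSums-suc s (suc k) p h) (concatMap-[] (All.map
    (λ {a} s+p≤a → cong (shift a) (chainSums-empty s k a h
       (<-≤-trans h<bound (subst (_≤ a + s * suc k) (sym (bound-step s p k)) (+-monoˡ-≤ (s * suc k) s+p≤a)))))
    (range-lowerBound (s + p) (suc h ∸ (s + p)))))
    where
      bound-step : ∀ s p k → p + s * suc (suc k) ≡ s + p + s * suc k
      bound-step = solve-∀

  triangular : ℕ → ℕ
  triangular zero    = 0
  triangular (suc n) = suc n + triangular n

  -- k * p + s * triangular k is the least sum of such a chain of length k.
  chainSums-closed : ∀ s k p j h → h ≡ p + s * k + j →
                     chainSums s k p h ↭ shift (k * p + s * triangular k) (gaussian k j)
  chainSums-closed s zero p j h _ = ↭-reflexive (cong [_] (sym (trans (+-identityʳ (s * 0)) (*-zeroʳ s))))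
  chainSums-closed s (suc k) p j h h≡ = begin
    chainSums s (suc k) p h
      ≡⟨ chainSums-step s k p h (subst (s + p ≤_) (sym h≡′) (m≤m+n (s + p) (s * k + j))) ⟩
    shift (s + p) (chainSums s k (s + p) h) ++ chainSums s (suc k) (suc p) h
      ↭⟨ ++⁺ʳ (chainSums s (suc k) (suc p) h) starting-at-min ⟩
    shift c (gaussian k j) ++ chainSums s (suc k) (suc p) h
      ↭⟨ starting-above-min j h≡ ⟩
    shift c (gaussian (suc k) j)
      ∎
    where
      open PermutationReasoning
      c = suc k * p + s * triangular (suc k)
      h≡′ : h ≡ s + p + (s * k + j)
      h≡′ = trans h≡ (regroup p s k j)
        where
          regroup : ∀ p s k j → p + s * suc k + j ≡ s + p + (s * k + j)
          regroup = solve-∀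
      starting-at-min : shift (s + p) (chainSums s k (s + p) h) ↭ shift c (gaussian k j)
      starting-at-min = begin
        shift (s + p) (chainSums s k (s + p) h)
          ↭⟨ map⁺ (s + p +_) (chainSums-closed s k (s + p) j h (trans h≡′ (sym (+-assoc (s + p) (s * k) j)))) ⟩
        shift (s + p) (shift (k * (s + p) + s * triangular k) (gaussian k j))
          ≡⟨ shift-shift (s + p) _ (gaussian k j) ⟩
        shift (s + p + (k * (s + p) + s * triangular k)) (gaussian k j)
          ≡⟨ cong (λ x → shift x (gaussian k j)) (offset-step s p k (triangular k)) ⟩
        shift c (gaussian k j)
          ∎
        where
          offset-step : ∀ s p k t → s + p + (k * (s + p) + s * t) ≡ suc k * p + s * (suc k + t)
          offset-step = solve-∀
      starting-above-min : ∀ j → h ≡ p + s * suc k + j →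
             shift c (gaussian k j) ++ chainSums s (suc k) (suc p) h ↭ shift c (gaussian (suc k) j)
      starting-above-min zero h≡ = ↭-reflexive (cong₂ (λ g t → shift c g ++ t) (gaussian-zeroʳ k)
        (chainSums-empty s k (suc p) h (subst (_< suc p + s * suc k) (sym (trans h≡ (+-identityʳ _))) ≤-refl)))
      starting-above-min (suc j) h≡ = begin
        shift c (gaussian k (suc j)) ++ chainSums s (suc k) (suc p) h
          ↭⟨ ++⁺ˡ (shift c (gaussian k (suc j)))
                  (chainSums-closed s (suc k) (suc p) j h (trans h≡ (regroup p s k j))) ⟩
        shift c (gaussian k (suc j)) ++ shift (suc k * suc p + s * triangular (suc k)) (gaussian (suc k) j)
          ≡⟨ cong (λ x → shift c (gaussian k (suc j)) ++ shift x (gaussian (suc k) j))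
                  (offset-suc s p k (triangular k)) ⟩
        shift c (gaussian k (suc j)) ++ shift (c + suc k) (gaussian (suc k) j)
          ≡⟨ shift-++-shift c (gaussian k (suc j)) (suc k) (gaussian (suc k) j) ⟨
        shift c (gaussian (suc k) (suc j))
          ∎
        where
          regroup : ∀ p s k j → p + s * suc k + suc j ≡ suc p + s * suc k + j
          regroup = solve-∀
          offset-suc : ∀ s p k t → suc k * suc p + s * (suc k + t) ≡ suc k * p + s * (suc k + t) + suc k
          offset-suc = solve-∀

  -- Hook tableaux

  hookTableau : ℕ → List ℕ → List ℕ → List (List ℕ)
  hookTableau a w c = (a ∷ w) ∷ map [_] c

  entrySum : List (List ℕ) → ℕ
  entrySum T = sum (concat T)

  weaklyInc-∷ : ∀ a w → weaklyInc (a ∷ w) ≡ chainFrom 0 a w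
  weaklyInc-∷ a []      = refl
  weaklyInc-∷ a (b ∷ w) = cong ((a ≤ᵇ b) ∧_) (weaklyInc-∷ b w)

  colStrict-hookTableau : ∀ a w c → colStrict (hookTableau a w c) ≡ chainFrom 1 a c
  colStrict-hookTableau a w       []      = refl
  colStrict-hookTableau a []      (b ∷ c) = cong₂ _∧_ (∧-identityʳ (a <ᵇ b)) (colStrict-hookTableau b [] c)
  colStrict-hookTableau a (x ∷ w) (b ∷ c) = cong₂ _∧_ (∧-identityʳ (a <ᵇ b)) (colStrict-hookTableau b [] c)

  entrySum-hookTableau : ∀ a w c → entrySum (hookTableau a w c) ≡ a + (sum w + sum c)
  entrySum-hookTableau a w c =
    cong (a +_) (trans (sum-++ w (concat (map [_] c))) (cong (λ c′ → sum w + sum c′) (concat-map-[_] c)))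

  filterᵇ'-weaklyInc-words : ∀ m h → filterᵇ' weaklyInc (words (suc m) h) ≡
    concatMap (λ a → map (a ∷_) (filterᵇ' (chainFrom 0 a) (words m h))) (upTo (suc h))
  filterᵇ'-weaklyInc-words m h = trans (filterᵇ'-words-suc weaklyInc m h)
    (concatMap-cong (λ a → cong (map (a ∷_)) (filterᵇ'-cong (weaklyInc-∷ a) (words m h))) (upTo (suc h)))

  rowFillings-column : ∀ n h → rowFillings (replicate n 1) h ≡ map (map [_]) (words n h)
  rowFillings-column zero    h = refl
  rowFillings-column (suc n) h = begin
    concatMap (λ r → map (r ∷_) (rowFillings (replicate n 1) h)) (filterᵇ' weaklyInc (words 1 h))
      ≡⟨ cong (concatMap (λ r → map (r ∷_) (rowFillings (replicate n 1) h))) singletons ⟩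
    concatMap (λ r → map (r ∷_) (rowFillings (replicate n 1) h)) (map [_] (upTo (suc h)))
      ≡⟨ concatMap-map _ [_] (upTo (suc h)) ⟩
    concatMap (λ a → map ([ a ] ∷_) (rowFillings (replicate n 1) h)) (upTo (suc h))
      ≡⟨ concatMap-cong (λ a → cong (map ([ a ] ∷_)) (rowFillings-column n h)) (upTo (suc h)) ⟩
    concatMap (λ a → map ([ a ] ∷_) (map (map [_]) (words n h))) (upTo (suc h))
      ≡⟨ concatMap-cong (λ a → trans (sym (map-∘ (words n h))) (map-∘ (words n h))) (upTo (suc h)) ⟩
    concatMap (λ a → map (map [_]) (map (a ∷_) (words n h))) (upTo (suc h))
      ≡⟨ map-concatMap (map [_]) _ (upTo (suc h)) ⟨
    map (map [_]) (words (suc n) h)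
      ∎
    where
      open ≡-Reasoning
      singletons : filterᵇ' weaklyInc (words 1 h) ≡ map [_] (upTo (suc h))
      singletons = trans (filterᵇ'-concatMap weaklyInc (λ a → [ [ a ] ]) (upTo (suc h)))
                         (trans (sym (concatMap-map [_] [_] (upTo (suc h)))) (concatMap-pure (map [_] (upTo (suc h)))))

  rowFillings-hook : ∀ m n h → rowFillings (hook m n) h ≡
    concatMap (λ a → concatMap (λ w → map (hookTableau a w) (words n h)) (filterᵇ' (chainFrom 0 a) (words m h)))
              (upTo (suc h))
  rowFillings-hook m n h = begin
    concatMap (λ r → map (r ∷_) (rowFillings (replicate n 1) h)) (filterᵇ' weaklyInc (words (suc m) h))
      ≡⟨ cong₂ (λ cs rs → concatMap (λ r → map (r ∷_) cs) rs)
               (rowFillings-column n h) (filterᵇ'-weaklyInc-words m h) ⟩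
    concatMap (λ r → map (r ∷_) (map (map [_]) Cs)) (concatMap (λ a → map (a ∷_) (As a)) U)
      ≡⟨ concatMap-concatMap (λ r → map (r ∷_) (map (map [_]) Cs)) (λ a → map (a ∷_) (As a)) U ⟩
    concatMap (λ a → concatMap (λ r → map (r ∷_) (map (map [_]) Cs)) (map (a ∷_) (As a))) U
      ≡⟨ concatMap-cong (λ a → trans (concatMap-map _ (a ∷_) (As a))
                                     (concatMap-cong (λ w → sym (map-∘ Cs)) (As a))) U ⟩
    concatMap (λ a → concatMap (λ w → map (hookTableau a w) Cs) (As a)) U
      ∎
    where
      open ≡-Reasoning
      U  = upTo (suc h)
      Cs = words n h
      As : ℕ → List (List ℕ)
      As a = filterᵇ' (chainFrom 0 a) (words m h)

  SSYT-hook : ∀ m n h → SSYT (hook m n) h ≡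
    concatMap (λ a → concatMap (λ w → map (hookTableau a w) (filterᵇ' (chainFrom 1 a) (words n h)))
                               (filterᵇ' (chainFrom 0 a) (words m h)))
              (upTo (suc h))
  SSYT-hook m n h = begin
    filterᵇ' colStrict (rowFillings (hook m n) h)
      ≡⟨ cong (filterᵇ' colStrict) (rowFillings-hook m n h) ⟩
    filterᵇ' colStrict (concatMap (λ a → concatMap (λ w → map (hookTableau a w) Cs) (As a)) U)
      ≡⟨ filterᵇ'-concatMap colStrict (λ a → concatMap (λ w → map (hookTableau a w) Cs) (As a)) U ⟩
    concatMap (λ a → filterᵇ' colStrict (concatMap (λ w → map (hookTableau a w) Cs) (As a))) U
      ≡⟨ concatMap-cong (λ a → trans (filterᵇ'-concatMap colStrict (λ w → map (hookTableau a w) Cs) (As a))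
                                     (concatMap-cong (legs a) (As a))) U ⟩
    concatMap (λ a → concatMap (λ w → map (hookTableau a w) (filterᵇ' (chainFrom 1 a) Cs)) (As a)) U
      ∎
    where
      open ≡-Reasoning
      U  = upTo (suc h)
      Cs = words n h
      As : ℕ → List (List ℕ)
      As a = filterᵇ' (chainFrom 0 a) (words m h)
      legs : ∀ a w →
             filterᵇ' colStrict (map (hookTableau a w) Cs) ≡ map (hookTableau a w) (filterᵇ' (chainFrom 1 a) Cs)
      legs a w = trans (filterᵇ'-map colStrict (hookTableau a w) Cs)
                       (cong (map (hookTableau a w)) (filterᵇ'-cong (colStrict-hookTableau a w) Cs))

  hookSums : ℕ → ℕ → ℕ → List ℕ
  hookSums m n h = map entrySum (SSYT (hook m n) h)

  cornerSums : ℕ → ℕ → ℕ → ℕ → List ℕ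
  cornerSums m n h a = shift a (chainSums 0 m a h ⊗ chainSums 1 n a h)

  hookSums-corners : ∀ m n h → hookSums m n h ≡ concatMap (cornerSums m n h) (upTo (suc h))
  hookSums-corners m n h = begin
    map entrySum (SSYT (hook m n) h)
      ≡⟨ cong (map entrySum) (SSYT-hook m n h) ⟩
    map entrySum (concatMap tableaux (upTo (suc h)))
      ≡⟨ map-concatMap entrySum tableaux (upTo (suc h)) ⟩
    concatMap (map entrySum ∘ tableaux) (upTo (suc h))
      ≡⟨ concatMap-cong corner (upTo (suc h)) ⟩
    concatMap (cornerSums m n h) (upTo (suc h))
      ∎
    where
      open ≡-Reasoning
      As Cs : ℕ → List (List ℕ)
      As a = filterᵇ' (chainFrom 0 a) (words m h)
      Cs a = filterᵇ' (chainFrom 1 a) (words n h)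
      tableaux : ℕ → List (List (List ℕ))
      tableaux a = concatMap (λ w → map (hookTableau a w) (Cs a)) (As a)
      corner : ∀ a → map entrySum (tableaux a) ≡ cornerSums m n h a
      corner a = begin
        map entrySum (tableaux a)
          ≡⟨ map-concatMap entrySum (λ w → map (hookTableau a w) (Cs a)) (As a) ⟩
        concatMap (λ w → map entrySum (map (hookTableau a w) (Cs a))) (As a)
          ≡⟨ concatMap-cong (λ w → trans (sym (map-∘ (Cs a))) (map-cong (entrySum-hookTableau a w) (Cs a))) (As a) ⟩
        concatMap (λ w → map (λ c → a + (sum w + sum c)) (Cs a)) (As a)
          ≡⟨ shift-map-⊗ a sum sum (As a) (Cs a) ⟨
        cornerSums m n h a
          ∎

  cornerSums-empty : ∀ m n h a → h < a + suc n → cornerSums m (suc n) h a ≡ []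
  cornerSums-empty m n h a h<a+n = cong (shift a) (trans
    (cong (chainSums 0 m a h ⊗_) (chainSums-empty 1 n a h (subst (λ x → h < a + x) (sym (+-identityʳ (suc n))) h<a+n)))
    (⊗-zeroʳ (chainSums 0 m a h)))

  hookSums-empty : ∀ m n h → h < n → hookSums m n h ≡ []
  hookSums-empty m (suc n) h h<n = trans (hookSums-corners m (suc n) h)
    (concatMap-[] (All.universal (λ a → cornerSums-empty m n h a (<-≤-trans h<n (m≤n+m (suc n) a))) (upTo (suc h))))

  cornerSums-beyond : ∀ m n K → concatMap (cornerSums m n (n + K)) (range (suc K) n) ≡ []
  cornerSums-beyond m zero    K = refl
  cornerSums-beyond m (suc n) K = concatMap-[] (All.map
    (λ {a} K<a → cornerSums-empty m n (suc n + K) a (subst (_< a + suc n) (+-comm K (suc n)) (+-monoˡ-< (suc n) K<a)))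
    (range-lowerBound (suc K) (suc n)))

  hookSums-truncate : ∀ m n K → hookSums m n (n + K) ≡ concatMap (cornerSums m n (n + K)) (upTo (suc K))
  hookSums-truncate m n K = begin
    hookSums m n (n + K)
      ≡⟨ hookSums-corners m n (n + K) ⟩
    concatMap (cornerSums m n (n + K)) (upTo (suc (n + K)))
      ≡⟨ cong (concatMap (cornerSums m n (n + K))) corners ⟩
    concatMap (cornerSums m n (n + K)) (upTo (suc K) ++ range (suc K) n)
      ≡⟨ concatMap-++ (cornerSums m n (n + K)) (upTo (suc K)) (range (suc K) n) ⟩
    concatMap (cornerSums m n (n + K)) (upTo (suc K)) ++ concatMap (cornerSums m n (n + K)) (range (suc K) n)
      ≡⟨ cong (concatMap (cornerSums m n (n + K)) (upTo (suc K)) ++_) (cornerSums-beyond m n K) ⟩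
    concatMap (cornerSums m n (n + K)) (upTo (suc K)) ++ []
      ≡⟨ ++-identityʳ _ ⟩
    concatMap (cornerSums m n (n + K)) (upTo (suc K))
      ∎
    where
      open ≡-Reasoning
      corners : upTo (suc (n + K)) ≡ upTo (suc K) ++ range (suc K) n
      corners = begin
        upTo (suc (n + K))                ≡⟨ upTo-range (suc (n + K)) ⟩
        range 0 (suc (n + K))             ≡⟨ cong (range 0 ∘ suc) (+-comm n K) ⟩
        range 0 (suc K + n)               ≡⟨ range-++ 0 (suc K) n ⟩
        range 0 (suc K) ++ range (suc K) n ≡⟨ cong (_++ range (suc K) n) (upTo-range (suc K)) ⟨
        upTo (suc K) ++ range (suc K) n   ∎

  cornerSums-closed : ∀ m n a r →
    shift (triangular m) (cornerSums m n (n + (a + r)) a) ↭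
    shift (a * suc (m + n) + (triangular m + triangular n)) (trinomial m n r)
  cornerSums-closed m n a r = begin
    shift (triangular m) (shift a (chainSums 0 m a h ⊗ chainSums 1 n a h))
      ↭⟨ map⁺ (triangular m +_) (map⁺ (a +_) (↭-trans
           (⊗-congˡ (chainSums 1 n a h) (chainSums-closed 0 m a (n + r) h (arm-height n a r)))
           (⊗-congʳ (shift arm G₁) (chainSums-closed 1 n a r h (leg-height n a r))))) ⟩
    shift (triangular m) (shift a (shift arm G₁ ⊗ shift leg G₂))
      ≡⟨ cong (shift (triangular m) ∘ shift a) (shift-⊗-shift arm G₁ leg G₂) ⟩
    shift (triangular m) (shift a (shift (arm + leg) (trinomial m n r)))
      ≡⟨ trans (cong (shift (triangular m)) (shift-shift a (arm + leg) (trinomial m n r)))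
               (shift-shift (triangular m) (a + (arm + leg)) (trinomial m n r)) ⟩
    shift (triangular m + (a + (arm + leg))) (trinomial m n r)
      ≡⟨ cong (λ c → shift c (trinomial m n r)) (corner-offset m n a (triangular m) (triangular n)) ⟩
    shift (a * suc (m + n) + (triangular m + triangular n)) (trinomial m n r)
      ∎
    where
      open PermutationReasoning
      h   = n + (a + r)
      G₁  = gaussian m (n + r)
      G₂  = gaussian n r
      arm = m * a + 0 * triangular m
      leg = n * a + 1 * triangular n
      arm-height : ∀ n a r → n + (a + r) ≡ a + 0 * m + (n + r)
      arm-height = solve-∀
      leg-height : ∀ n a r → n + (a + r) ≡ a + 1 * n + r
      leg-height = solve-∀
      corner-offset : ∀ m n a tm tn → tm + (a + (m * a + 0 * tm + (n * a + 1 * tn))) ≡ a * suc (m + n) + (tm + tn)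
      corner-offset = solve-∀

  cornerSums-transpose : ∀ m n K a → a ≤ K →
    shift (triangular m) (cornerSums m n (n + K) a) ↭ shift (triangular n) (cornerSums n m (m + K) a)
  cornerSums-transpose m n K a a≤K with r , refl ← m≤n⇒∃[o]m+o≡n a≤K = begin
    shift (triangular m) (cornerSums m n (n + (a + r)) a)
      ↭⟨ cornerSums-closed m n a r ⟩
    shift (a * suc (m + n) + (triangular m + triangular n)) (trinomial m n r)
      ↭⟨ map⁺ _ (trinomial-comm m n r) ⟩
    shift (a * suc (m + n) + (triangular m + triangular n)) (trinomial n m r)
      ≡⟨ cong (λ c → shift c (trinomial n m r))
              (cong₂ (λ x y → a * suc x + y) (+-comm m n) (+-comm (triangular m) (triangular n))) ⟩
    shift (a * suc (n + m) + (triangular n + triangular m)) (trinomial n m r)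
      ↭⟨ cornerSums-closed n m a r ⟨
    shift (triangular n) (cornerSums n m (m + (a + r)) a)
      ∎
    where open PermutationReasoning

  hookSums-transpose : ∀ m n K →
    shift (triangular m) (hookSums m n (n + K)) ↭ shift (triangular n) (hookSums n m (m + K))
  hookSums-transpose m n K = begin
    shift (triangular m) (hookSums m n (n + K))
      ≡⟨ cong (shift (triangular m)) (hookSums-truncate m n K) ⟩
    shift (triangular m) (concatMap (cornerSums m n (n + K)) (upTo (suc K)))
      ≡⟨ map-concatMap (triangular m +_) (cornerSums m n (n + K)) (upTo (suc K)) ⟩
    concatMap (shift (triangular m) ∘ cornerSums m n (n + K)) (upTo (suc K))
      ↭⟨ concatMap-cong-↭ (All.map (λ {a} a<1+K → cornerSums-transpose m n K a (s≤s⁻¹ a<1+K))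
                                   (all-upTo (suc K))) ⟩
    concatMap (shift (triangular n) ∘ cornerSums n m (m + K)) (upTo (suc K))
      ≡⟨ map-concatMap (triangular n +_) (cornerSums n m (m + K)) (upTo (suc K)) ⟨
    shift (triangular n) (concatMap (cornerSums n m (m + K)) (upTo (suc K)))
      ≡⟨ cong (shift (triangular n)) (hookSums-truncate n m K) ⟨
    shift (triangular n) (hookSums n m (m + K))
      ∎
    where open PermutationReasoning

  -- Principal specialisation

  words-length : ∀ k h → All (λ w → length w ≡ k) (words k h)
  words-length zero    h = refl ∷ []
  words-length (suc k) h = All.concat⁺ (All.map⁺ (All.universal
    (λ a → All.map⁺ (All.map (cong suc) (words-length k h))) (upTo (suc h))))

  rowFillings-size : ∀ λs h → All (λ T → length (concat T) ≡ sum λs) (rowFillings λs h)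
  rowFillings-size []       h = refl ∷ []
  rowFillings-size (l ∷ λs) h = All.concat⁺ (All.map⁺ (All.map
    (λ {r} |r|≡l → All.map⁺ (All.map (λ {T} |T|≡ → trans (length-++ r) (cong₂ _+_ |r|≡l |T|≡))
                                     (rowFillings-size λs h)))
    (All-filterᵇ' weaklyInc (words-length l h))))

  sum-hook : ∀ m n → sum (hook m n) ≡ suc (m + n)
  sum-hook m n = cong (suc ∘ (m +_)) (sum-replicate-1 n)
    where
      sum-replicate-1 : ∀ n → sum (replicate n 1) ≡ n
      sum-replicate-1 zero    = refl
      sum-replicate-1 (suc n) = cong suc (sum-replicate-1 n)

  exponent : ℕ → ℕ → ℤ
  exponent c s = ℤ.+ (2 * s) ℤ.- ℤ.+ c

  schurPS-hook : ∀ m n h → schurPS (hook m n) (ℤ.+ h) ≡ map (exponent (h * suc (m + n))) (hookSums m n h)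
  schurPS-hook m n h = trans
    (map-cong-local (All.map (λ {T} |T|≡ → cong (λ L → exponent (h * L) (entrySum T)) (trans |T|≡ (sum-hook m n)))
                             (All-filterᵇ' colStrict (rowFillings-size (hook m n) h))))
    (map-∘ (SSYT (hook m n) h))

  schurPS-hook-empty : ∀ m n h → h < n → schurPS (hook m n) (ℤ.+ h) ≡ []
  schurPS-hook-empty m n h h<n = trans (schurPS-hook m n h) (cong (map _) (hookSums-empty m n h h<n))

  exponent-shift : ∀ c t s → exponent c s ≡ exponent (c + 2 * t) (t + s)
  exponent-shift c t s = sym (begin
    ℤ.+ (2 * (t + s)) ℤ.- ℤ.+ (c + 2 * t)
      ≡⟨ cong₂ ℤ._-_ (trans (cong ℤ.+_ (*-distribˡ-+ 2 t s)) (pos-+ (2 * t) (2 * s))) (pos-+ c (2 * t)) ⟩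
    (ℤ.+ (2 * t) ℤ.+ ℤ.+ (2 * s)) ℤ.- (ℤ.+ c ℤ.+ ℤ.+ (2 * t))
      ≡⟨ cancel (ℤ.+ (2 * t)) (ℤ.+ (2 * s)) (ℤ.+ c) ⟩
    ℤ.+ (2 * s) ℤ.- ℤ.+ c
      ∎)
    where
      open ≡-Reasoning
      cancel : ∀ x y z → (x ℤ.+ y) ℤ.- (z ℤ.+ x) ≡ y ℤ.- z
      cancel = ℤ-solve-∀

  map-exponent-shift : ∀ c t xs → map (exponent c) xs ≡ map (exponent (c + 2 * t)) (shift t xs)
  map-exponent-shift c t xs = trans (map-cong (exponent-shift c t) xs) (map-∘ xs)

  triangular-double : ∀ n → 2 * triangular n ≡ n * suc n
  triangular-double zero    = refl
  triangular-double (suc n) = begin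
    2 * (suc n + triangular n)        ≡⟨ *-distribˡ-+ 2 (suc n) (triangular n) ⟩
    2 * suc n + 2 * triangular n      ≡⟨ cong (2 * suc n +_) (triangular-double n) ⟩
    2 * suc n + n * suc n             ≡⟨ gauss-step n ⟩
    suc n * suc (suc n)               ∎
    where
      open ≡-Reasoning
      gauss-step : ∀ n → 2 * suc n + n * suc n ≡ suc n * suc (suc n)
      gauss-step = solve-∀

  hook-degree-symmetric : ∀ m n K →
    (n + K) * suc (m + n) + 2 * triangular m ≡ (m + K) * suc (n + m) + 2 * triangular n
  hook-degree-symmetric m n K = begin
    (n + K) * suc (m + n) + 2 * triangular m   ≡⟨ cong ((n + K) * suc (m + n) +_) (triangular-double m) ⟩
    (n + K) * suc (m + n) + m * suc m          ≡⟨ expand m n K ⟩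
    (m + K) * suc (n + m) + n * suc n          ≡⟨ cong ((m + K) * suc (n + m) +_) (triangular-double n) ⟨
    (m + K) * suc (n + m) + 2 * triangular n   ∎
    where
      open ≡-Reasoning
      expand : ∀ m n K → (n + K) * suc (m + n) + m * suc m ≡ (m + K) * suc (n + m) + n * suc n
      expand = solve-∀

  schurPS-hook-transpose : ∀ m n K → schurPS (hook m n) (ℤ.+ (n + K)) ↭ schurPS (hook n m) (ℤ.+ (m + K))
  schurPS-hook-transpose m n K = begin
    schurPS (hook m n) (ℤ.+ (n + K))
      ≡⟨ schurPS-hook m n (n + K) ⟩
    map (exponent ((n + K) * suc (m + n))) (hookSums m n (n + K))
      ≡⟨ map-exponent-shift ((n + K) * suc (m + n)) (triangular m) (hookSums m n (n + K)) ⟩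
    map (exponent ((n + K) * suc (m + n) + 2 * triangular m)) (shift (triangular m) (hookSums m n (n + K)))
      ↭⟨ map⁺ _ (hookSums-transpose m n K) ⟩
    map (exponent ((n + K) * suc (m + n) + 2 * triangular m)) (shift (triangular n) (hookSums n m (m + K)))
      ≡⟨ cong (λ c → map (exponent c) (shift (triangular n) (hookSums n m (m + K)))) (hook-degree-symmetric m n K) ⟩
    map (exponent ((m + K) * suc (n + m) + 2 * triangular n)) (shift (triangular n) (hookSums n m (m + K)))
      ≡⟨ map-exponent-shift ((m + K) * suc (n + m)) (triangular n) (hookSums n m (m + K)) ⟨
    map (exponent ((m + K) * suc (n + m))) (hookSums n m (m + K))
      ≡⟨ schurPS-hook n m (m + K) ⟨
    schurPS (hook n m) (ℤ.+ (m + K))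
      ∎
    where open PermutationReasoning

open HookSchur using (schurPS-hook-transpose; schurPS-hook-empty)
open import Data.Integer using (+_; -[1+_]; _+_; _-_)
open import Data.Integer.Properties using (pos-+; +-injective)
open import Data.Integer.Tactic.RingSolver using (solve-∀)
open import Data.Nat as ℕ using (ℕ; _<_; _≤?_)
open import Data.Nat.Properties using (≰⇒>; m≤n⇒∃[o]m+o≡n; +-cancelʳ-<; +-monoʳ-<)
open import Data.List using ([])
open import Data.List.Relation.Binary.Permutation.Propositional using (_↭_; ↭-reflexive)
open import Data.Product using (_,_)
open import Relation.Binary.PropositionalEquality using (_≡_; refl; sym; trans; cong; subst; module ≡-Reasoning)
open import Relation.Nullary using (yes; no)

transposed-degree : ∀ m n K → (+ m - + n) + + (n ℕ.+ K) ≡ + (m ℕ.+ K)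
transposed-degree m n K = begin
  (+ m - + n) + + (n ℕ.+ K)   ≡⟨ cong (λ z → (+ m - + n) + z) (pos-+ n K) ⟩
  (+ m - + n) + (+ n + + K)   ≡⟨ cancel (+ m) (+ n) (+ K) ⟩
  + m + + K                   ≡⟨ pos-+ m K ⟨
  + (m ℕ.+ K)                 ∎
  where
    open ≡-Reasoning
    cancel : ∀ x y z → (x - y) + (y + z) ≡ x + z
    cancel = solve-∀

schurPS-transposed-empty : ∀ m n d → d < n → schurPS (hook n m) ((+ m - + n) + + d) ≡ []
schurPS-transposed-empty m n d d<n with (+ m - + n) + + d in degree
... | -[1+ _ ] = refl
... | + h      =
  schurPS-hook-empty n m h (+-cancelʳ-< n h m (subst (ℕ._< m ℕ.+ n) (sym h+n≡m+d) (+-monoʳ-< m d<n)))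
  where
    h+n≡m+d : h ℕ.+ n ≡ m ℕ.+ d
    h+n≡m+d = +-injective (begin
      + (h ℕ.+ n)                  ≡⟨ pos-+ h n ⟩
      + h + + n                    ≡⟨ cong (λ z → z + + n) degree ⟨
      ((+ m - + n) + + d) + + n    ≡⟨ cancel (+ m) (+ n) (+ d) ⟩
      + m + + d                    ≡⟨ pos-+ m d ⟨
      + (m ℕ.+ d)                  ∎)
      where
        open ≡-Reasoning
        cancel : ∀ x y z → ((x - y) + z) + y ≡ x + z
        cancel = solve-∀

corollary5p14 : (n m d : ℕ) →
    schurPS (hook m n) (+ d) ↭ schurPS (hook n m) ((+ m - + n) + + d)
corollary5p14 n m d with n ≤? d
... | yes n≤d with K , refl ← m≤n⇒∃[o]m+o≡n n≤d =
  subst (schurPS (hook m n) (+ (n ℕ.+ K)) ↭_) (cong (schurPS (hook n m)) (sym (transposed-degree m n K)))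
        (schurPS-hook-transpose m n K)
... | no n≰d =
  ↭-reflexive (trans (schurPS-hook-empty m n d (≰⇒> n≰d)) (sym (schurPS-transposed-empty m n d (≰⇒> n≰d))))
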